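{- For every integer $\Delta\geq 3$ there exists a real $\alpha>0$ such that there are infinitely many trees $X$ with maximum degree $\Delta$ with the following property: for every tree $T$ with maximum degree less than $\Delta$, every $T$-partition of $X$ has width at least $|V(X)|^{\alpha}$. Moreover, if $\Delta=3$, then for every $\alpha\in(0,1)$ there are infinitely many trees $X$ with maximum degree $3$ such that for every tree $T$ with maximum degree less than $3$, every $T$-partition of $X$ has width at least $|V(X)|^{\alpha}$.
   Context: For a graph $G$ and a tree $T$, a $T$-partition of $G$ is a partition $(V_x : x\in V(T))$ of $V(G)$ indexed by the nodes of $T$ (parts may be empty) such that for every edge $vw$ of $G$, if $v\in V_x$ and $w\in V_y$ then $x=y$ or $xy\in E(T)$. Its width is $\max\{|V_x| : x\in V(T)\}$. All graphs are finite. -}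

module Defs where

open import Data.Nat using (ℕ; zero; suc; _+_; _≤_; _<_; _^_; _⊔_)
open import Data.Fin using (Fin)
open import Data.Fin.Properties using (_≟_)
open import Data.Bool using (Bool; true; false; if_then_else_)
open import Data.List using (List; []; _∷_; _++_; length; foldr; map; allFin)
open import Data.List.Relation.Unary.Unique.Propositional using (Unique)
open import Data.Product using (Σ; _×_)
open import Data.Sum using (_⊎_)
open import Relation.Binary.PropositionalEquality using (_≡_)
open import Relation.Nullary.Decidable using (⌊_⌋)

record Graph : Set where
  field
    size  : ℕ
    adj   : Fin size → Fin size → Bool
    sym   : ∀ u v → adj u v ≡ adj v u
    irrefl : ∀ u → adj u u ≡ false
open Graph public

V : Graph → Set
V G = Fin (size G)

Adj : (G : Graph) → V G → V G → Set
Adj G u v = adj G u v ≡ true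

sumFin : (n : ℕ) → (Fin n → ℕ) → ℕ
sumFin n f = foldr _+_ 0 (map f (allFin n))

maxFin : (n : ℕ) → (Fin n → ℕ) → ℕ
maxFin n f = foldr _⊔_ 0 (map f (allFin n))

degree : (G : Graph) → V G → ℕ
degree G v = sumFin (size G) (λ w → if adj G v w then 1 else 0)

HasMaxDegree : Graph → ℕ → Set
HasMaxDegree G Δ = (∀ v → degree G v ≤ Δ) × Σ (V G) (λ v → degree G v ≡ Δ)

data Chain (G : Graph) : List (V G) → Set where
  []  : Chain G []
  [-] : ∀ u → Chain G (u ∷ [])
  _∷_ : ∀ {u v vs} → Adj G u v → Chain G (v ∷ vs) → Chain G (u ∷ v ∷ vs)

data Walk (G : Graph) : V G → V G → Set where
  here : ∀ {u} → Walk G u u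
  step : ∀ {u w v} → Adj G u w → Walk G w v → Walk G u v

Connected : Graph → Set
Connected G = (0 < size G) × (∀ u v → Walk G u v)

HasCycle : Graph → Set
HasCycle G = Σ (V G) λ u → Σ (List (V G)) λ xs →
  (2 ≤ length xs) × Unique (u ∷ xs) × Chain G (u ∷ xs ++ u ∷ [])

IsTree : Graph → Set
IsTree G = Connected G × (HasCycle G → Data.Empty.⊥)
  where import Data.Empty

-- a T-partition of X, given as the map sending each vertex to the index of its part
IsTPartition : (X T : Graph) → (V X → V T) → Set
IsTPartition X T f = ∀ v w → Adj X v w → (f v ≡ f w) ⊎ Adj T (f v) (f w)

partSize : (X T : Graph) → (V X → V T) → V T → ℕ
partSize X T f x = sumFin (size X) (λ v → if ⌊ f v ≟ x ⌋ then 1 else 0)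

width : (X T : Graph) → (V X → V T) → ℕ
width X T f = maxFin (size T) (partSize X T f)

-- X is a tree of max degree Δ such that every T-partition of X with T a tree of
-- max degree < Δ has width ≥ |V(X)|^(p/q), i.e. width^q ≥ |V(X)|^p
Good : ℕ → ℕ → ℕ → Graph → Set
Good Δ p q X = IsTree X × HasMaxDegree X Δ ×
  (∀ (T : Graph) → IsTree T → (∀ x → degree T x < Δ) →
     ∀ (f : V X → V T) → IsTPartition X T f → size X ^ p ≤ width X T f ^ q)

-- infinitely many such trees: arbitrarily large ones
InfinitelyManyGood : ℕ → ℕ → ℕ → Set
InfinitelyManyGood Δ p q = ∀ (N : ℕ) → Σ Graph λ X → (N ≤ size X) × Good Δ p q X

{-# OPTIONS --safe #-}
-- The trees are complete heaps: vertices 0, …, d^h − 1, the parent of c > 0 being ⌊(c − 1)/d⌋,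
-- so the maximum degree is d + 1 = Δ. If f is a T-partition and T has maximum degree at most d,
-- induction on depth shows that f maps the vertices of depth at most k into the ball of radius k
-- around f(root). Every vertex of that ball ends a non-backtracking walk of length at most k from
-- the centre, so the ball has at most d(d − 1)^k vertices, or 2k + 1 when d = 2. Counting the d^h
-- vertices part by part gives d^h ≤ d(d − 1)^h · width. For Δ ≥ 4 this bounds the width below by a
-- fixed power of d^h (Bernoulli's inequality supplies the exponent); for Δ = 3 it gives
-- width ≥ 2^h / (2h + 1), which beats 2^(αh) for every α < 1.

module Submission where

open import Defs hiding (sym)
open import Data.Nat hiding (_≟_)
open import Data.Nat.Properties hiding (_≟_)
open import Data.Nat.Properties using () renaming (_≟_ to _≟ℕ_)
open import Data.Nat.DivMod
  using (_/_; _%_; m/n≤m; m%n<n; m≡m%n+[m/n]*n; m/n≡1+[m∸n]/n; m<n⇒m/n≡0; 0/n≡0; m<n*o⇒m/o<n)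
open import Data.Nat.Tactic.RingSolver using (solve-∀)
open import Algebra.Properties.CommutativeSemigroup +-commutativeSemigroup using (interchange)
open import Data.Fin using (Fin; zero; suc; toℕ; fromℕ<)
open import Data.Fin.Properties using (_≟_; toℕ-injective; toℕ<n; toℕ-fromℕ<) renaming (suc-injective to Fin-suc-injective)
open import Data.Bool using (Bool; true; false; if_then_else_)
open import Data.Bool.Properties using (∨-comm; T-≡)
open import Function.Bundles using (Equivalence)
open import Data.List using (List; []; _∷_; _++_; _∷ʳ_; length; drop; foldr; map; concatMap; filter; filterᵇ; allFin; applyUpTo)
open import Data.List.Properties using (map-tabulate; length-++; length-map; length-applyUpTo; filter-notAll)
open import Data.List.Membership.Propositional using (_∈_)
open import Data.List.Membership.Propositional.Properties using (∈-allFin; ∈-map⁺; ∈-map⁻; ∈-++⁺ˡ; ∈-++⁺ʳ; ∈-++⁻; ∈-concat⁺′; ∈-concat⁻′; ∈-filter⁺; ∈-filter⁻; ∈-applyUpTo⁺)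
open import Data.List.Relation.Unary.All as All using (All; []; _∷_)
open import Data.List.Relation.Unary.AllPairs as AllPairs using ([]; _∷_)
open import Data.List.Relation.Unary.Linked using (Linked; [-]; _∷_)
open import Data.List.Relation.Unary.Linked.Properties using (Linked⇒AllPairs)
open import Data.List.Relation.Unary.Unique.Propositional using (Unique)
import Data.List.Relation.Unary.Unique.Propositional.Properties as Unique
open import Data.List.Relation.Unary.Any as Any using (Any; here; there)
open import Data.Product using (Σ; _×_; _,_; proj₁; proj₂)
open import Data.Sum using (_⊎_; inj₁; inj₂; [_,_])
open import Function using (_∘_; id; flip)
open import Relation.Binary.Definitions using (DecidableEquality; Transitive; tri<; tri≈; tri>)
open import Relation.Binary.PropositionalEquality
  using (_≡_; _≢_; ≢-sym; refl; sym; trans; cong; cong₂; subst; module ≡-Reasoning)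
open import Relation.Nullary using (¬_; Dec; does; yes; no)
open import Data.Empty using (⊥; ⊥-elim)
open import Data.Unit using (⊤; tt)
open import Relation.Nullary.Decidable using (⌊_⌋; ¬?; T?; _×-dec_; _⊎-dec_; dec-true; dec-false)

does⇒witness : ∀ {A : Set} (a? : Dec A) → does a? ≡ true → A
does⇒witness (yes a) _ = a

indicator : Bool → ℕ
indicator b = if b then 1 else 0

indicator≤1 : ∀ b → indicator b ≤ 1
indicator≤1 true = ≤-refl
indicator≤1 false = z≤n

indicator-true : ∀ {b} → b ≡ true → 1 ≤ indicator b
indicator-true refl = ≤-refl

indicator-split : ∀ b c → indicator c ≤ indicator b + indicator (if b then false else c)
indicator-split true c = ≤-trans (indicator≤1 c) (m≤m+n 1 0)
indicator-split false c = ≤-refl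

indicator-merge : ∀ b c → (b ≡ true → c ≡ true) → indicator b + indicator (if b then false else c) ≡ indicator c
indicator-merge true c b⇒c rewrite b⇒c refl = refl
indicator-merge false c _ = refl

sumFin-suc : ∀ n (f : Fin (suc n) → ℕ) → sumFin (suc n) f ≡ f zero + sumFin n (f ∘ suc)
sumFin-suc n f = cong (λ xs → f zero + foldr _+_ 0 xs)
  (trans (map-tabulate suc f) (sym (map-tabulate id (f ∘ suc))))

sumFin-mono : ∀ n {f g : Fin n → ℕ} → (∀ x → f x ≤ g x) → sumFin n f ≤ sumFin n g
sumFin-mono zero f≤g = z≤n
sumFin-mono (suc n) {f} {g} f≤g = begin
  sumFin (suc n) f             ≡⟨ sumFin-suc n f ⟩
  f zero + sumFin n (f ∘ suc)  ≤⟨ +-mono-≤ (f≤g zero) (sumFin-mono n (f≤g ∘ suc)) ⟩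
  g zero + sumFin n (g ∘ suc)  ≡⟨ sumFin-suc n g ⟨
  sumFin (suc n) g             ∎
  where open ≤-Reasoning

sumFin-+ : ∀ n (f g : Fin n → ℕ) → sumFin n (λ x → f x + g x) ≡ sumFin n f + sumFin n g
sumFin-+ zero f g = refl
sumFin-+ (suc n) f g = begin
  sumFin (suc n) (λ x → f x + g x)                           ≡⟨ sumFin-suc n _ ⟩
  (f zero + g zero) + sumFin n (λ x → f (suc x) + g (suc x)) ≡⟨ cong (f zero + g zero +_) (sumFin-+ n (f ∘ suc) (g ∘ suc)) ⟩
  (f zero + g zero) + (sumFin n (f ∘ suc) + sumFin n (g ∘ suc)) ≡⟨ interchange (f zero) (g zero) _ _ ⟩
  (f zero + sumFin n (f ∘ suc)) + (g zero + sumFin n (g ∘ suc)) ≡⟨ cong₂ _+_ (sumFin-suc n f) (sumFin-suc n g) ⟨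
  sumFin (suc n) f + sumFin (suc n) g                          ∎
  where open ≡-Reasoning

sumFin-vanishes : ∀ n {f : Fin n → ℕ} → (∀ x → f x ≡ 0) → sumFin n f ≡ 0
sumFin-vanishes zero _ = refl
sumFin-vanishes (suc n) {f} f≡0 = trans (sumFin-suc n f) (cong₂ _+_ (f≡0 zero) (sumFin-vanishes n (f≡0 ∘ suc)))

sumFin-const : ∀ n c → sumFin n (λ _ → c) ≡ n * c
sumFin-const zero c = refl
sumFin-const (suc n) c = trans (sumFin-suc n _) (cong (c +_) (sumFin-const n c))

∈⇒≤foldr-⊔ : ∀ {x xs} → x ∈ xs → x ≤ foldr _⊔_ 0 xs
∈⇒≤foldr-⊔ {xs = y ∷ ys} (here refl) = m≤m⊔n y _
∈⇒≤foldr-⊔ {xs = y ∷ ys} (there x∈ys) = ≤-trans (∈⇒≤foldr-⊔ x∈ys) (m≤n⊔m y _)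

maxFin-upper : ∀ n (f : Fin n → ℕ) x → f x ≤ maxFin n f
maxFin-upper n f x = ∈⇒≤foldr-⊔ (∈-map⁺ f (∈-allFin x))

sumFin-≥-interval : ∀ n (g : Fin n → ℕ) a k → a + k ≤ n →
  (∀ v → a ≤ toℕ v → toℕ v < a + k → 1 ≤ g v) → k ≤ sumFin n g
sumFin-≥-interval n g zero zero _ _ = z≤n
sumFin-≥-interval (suc n) g zero (suc k) (s≤s k≤n) g≥1 rewrite sumFin-suc n g =
  +-mono-≤ (g≥1 zero z≤n (s≤s z≤n)) (sumFin-≥-interval n (g ∘ suc) zero k k≤n (λ v _ v<k → g≥1 (suc v) z≤n (s≤s v<k)))
sumFin-≥-interval (suc n) g (suc a) k (s≤s a+k≤n) g≥1 rewrite sumFin-suc n g =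
  ≤-trans (sumFin-≥-interval n (g ∘ suc) a k a+k≤n (λ v a≤v v<a+k → g≥1 (suc v) (s≤s a≤v) (s≤s v<a+k))) (m≤n+m _ (g zero))

-- Counting points by fibres

module Fibres {A : Set} (_≟ᴬ_ : DecidableEquality A) {n : ℕ} (g : Fin n → A) where

  fibreSize : A → ℕ
  fibreSize a = sumFin n (λ v → indicator ⌊ g v ≟ᴬ a ⌋)

  count≤length*maxFibre : ∀ c → (∀ a → fibreSize a ≤ c) →
    ∀ (L : List A) (P : Fin n → Bool) → (∀ v → P v ≡ true → g v ∈ L) →
    sumFin n (indicator ∘ P) ≤ length L * c
  count≤length*maxFibre c fibre≤c [] P P⇒∈ = ≤-reflexive (sumFin-vanishes n P≡false)
    where
    P≡false : ∀ v → indicator (P v) ≡ 0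
    P≡false v with P v in eq
    ... | false = refl
    ... | true with () ← P⇒∈ v eq
  count≤length*maxFibre c fibre≤c (a ∷ L) P P⇒∈ = begin
    sumFin n (indicator ∘ P)                          ≤⟨ sumFin-mono n (λ v → indicator-split ⌊ g v ≟ᴬ a ⌋ (P v)) ⟩
    sumFin n (λ v → indicator ⌊ g v ≟ᴬ a ⌋ + indicator (P′ v))
                                                      ≡⟨ sumFin-+ n _ _ ⟩
    fibreSize a + sumFin n (indicator ∘ P′)           ≤⟨ +-mono-≤ (fibre≤c a) (count≤length*maxFibre c fibre≤c L P′ P′⇒∈) ⟩
    c + length L * c                                  ∎
    where
    open ≤-Reasoning
    P′ : Fin n → Bool
    P′ v = if ⌊ g v ≟ᴬ a ⌋ then false else P v
    P′⇒∈ : ∀ v → P′ v ≡ true → g v ∈ L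
    P′⇒∈ v P′v with g v ≟ᴬ a | P⇒∈ v
    ... | no  gv≢a | P⇒∈v with P⇒∈v P′v
    ...   | here gv≡a = ⊥-elim (gv≢a gv≡a)
    ...   | there gv∈L = gv∈L

open Fibres using (fibreSize; count≤length*maxFibre)

fibreSize-injective≤1 : ∀ {A : Set} (_≟ᴬ_ : DecidableEquality A) {n} (g : Fin n → A) →
  (∀ {v w} → g v ≡ g w → v ≡ w) → ∀ a → fibreSize _≟ᴬ_ g a ≤ 1
fibreSize-injective≤1 _≟ᴬ_ {zero} g g-inj a = z≤n
fibreSize-injective≤1 _≟ᴬ_ {suc n} g g-inj a
  rewrite sumFin-suc n (λ v → indicator ⌊ g v ≟ᴬ a ⌋) with g zero ≟ᴬ a
... | no _ = fibreSize-injective≤1 _≟ᴬ_ (g ∘ suc) (Fin-suc-injective ∘ g-inj) a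
... | yes g0≡a = ≤-reflexive (cong suc (sumFin-vanishes n others-miss))
  where
  others-miss : ∀ v → indicator ⌊ g (suc v) ≟ᴬ a ⌋ ≡ 0
  others-miss v with g (suc v) ≟ᴬ a
  ... | no _ = refl
  ... | yes gv≡a with () ← g-inj (trans gv≡a (sym g0≡a))

size≤length*width : (X T : Graph) (f : V X → V T) (L : List (V T)) →
  (∀ v → f v ∈ L) → size X ≤ length L * width X T f
size≤length*width X T f L f∈L = begin
  size X                                ≡⟨ *-identityʳ (size X) ⟨
  size X * 1                            ≡⟨ sumFin-const (size X) 1 ⟨
  sumFin (size X) (λ _ → 1)             ≤⟨ count≤length*maxFibre _≟_ f (width X T f)
                                             (maxFin-upper (size T) (partSize X T f)) L (λ _ → true) (λ v _ → f∈L v) ⟩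
  length L * width X T f                ∎
  where open ≤-Reasoning

-- Walks, connectivity and acyclicity

adj-sym : ∀ (G : Graph) {u v} → Adj G u v → Adj G v u
adj-sym G {u} {v} uv = trans (Graph.sym G v u) uv

adj⇒≢ : ∀ (G : Graph) {u v} → Adj G u v → u ≢ v
adj⇒≢ G uv refl with () ← trans (sym uv) (Graph.irrefl G _)

_++ʷ_ : ∀ {G u v w} → Walk G u v → Walk G v w → Walk G u w
here ++ʷ q = q
step a p ++ʷ q = step a (p ++ʷ q)

reverseʷ : ∀ {G u v} → Walk G u v → Walk G v u
reverseʷ here = here
reverseʷ {G} (step a p) = reverseʷ p ++ʷ step (adj-sym G a) here

module _ (G : Graph) (rank : V G → ℕ) (root : V G)
         (descend : ∀ v → v ≢ root → Σ (V G) λ w → Adj G v w × rank w < rank v) where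

  walk-to-root : ∀ v → Walk G v root
  walk-to-root v = walk-down (suc (rank v)) v ≤-refl
    where
    walk-down : ∀ k v → rank v < k → Walk G v root
    walk-down (suc k) v rank<k with v ≟ root
    ... | yes refl = here
    ... | no v≢root with descend v v≢root
    ...   | w , vw , w<v = step vw (walk-down k w (≤-trans w<v (≤-pred rank<k)))

  connected-by-descent : Connected G
  connected-by-descent = ≤-trans (s≤s z≤n) (toℕ<n root) ,
    λ u v → walk-to-root u ++ʷ reverseʷ (walk-to-root v)

NonBacktracking : ∀ {A : Set} → List A → Set
NonBacktracking (x ∷ y ∷ z ∷ xs) = x ≢ z × NonBacktracking (y ∷ z ∷ xs)
NonBacktracking _ = ⊤

nonBacktracking-∷ʳ : ∀ {A : Set} {u : A} xs → Unique xs → All (_≢ u) (drop 1 xs) → 3 ≤ length xs →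
  NonBacktracking (xs ∷ʳ u)
nonBacktracking-∷ʳ (_ ∷ []) _ _ (s≤s ())
nonBacktracking-∷ʳ (_ ∷ _ ∷ []) _ _ (s≤s (s≤s ()))
nonBacktracking-∷ʳ (a ∷ b ∷ c ∷ []) ((_ ∷ a≢c ∷ []) ∷ _) (b≢u ∷ _) _ = a≢c , b≢u , tt
nonBacktracking-∷ʳ (a ∷ b ∷ c ∷ d ∷ xs) ((_ ∷ a≢c ∷ _) ∷ uniq) (_ ∷ ≢u) _ =
  a≢c , nonBacktracking-∷ʳ (b ∷ c ∷ d ∷ xs) uniq ≢u (s≤s (s≤s (s≤s z≤n)))

nonBacktracking-closed : ∀ {A : Set} {x : A} ys → Unique (x ∷ ys) → 2 ≤ length ys →
  NonBacktracking (x ∷ ys ∷ʳ x)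
nonBacktracking-closed {x = x} ys uniq 2≤len =
  nonBacktracking-∷ʳ (x ∷ ys) uniq (All.map ≢-sym (AllPairs.head uniq)) (s≤s 2≤len)

unique-rotate : ∀ {A : Set} {x : A} {xs} → Unique (x ∷ xs) → Unique (xs ∷ʳ x)
unique-rotate (x∉xs ∷ uniq) = Unique.++⁺ uniq ([] ∷ []) λ where
  (v∈xs , here refl) → All.lookup x∉xs v∈xs refl

Linked-closed : ∀ {A : Set} {R : A → A → Set} → Transitive R →
  ∀ {x} xs → Linked R (x ∷ xs ∷ʳ x) → R x x
Linked-closed R-trans xs linked =
  All.lookup (AllPairs.head (Linked⇒AllPairs R-trans linked)) (∈-++⁺ʳ xs (here refl))

chain-∷ʳ : ∀ {G} xs {a b} → Chain G (xs ∷ʳ a) → Adj G a b → Chain G (xs ∷ʳ a ∷ʳ b)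
chain-∷ʳ [] ([-] a) ab = ab ∷ [-] _
chain-∷ʳ (x ∷ []) (xa ∷ [-] a) ab = xa ∷ ab ∷ [-] _
chain-∷ʳ (x ∷ y ∷ xs) (xy ∷ ch) ab = xy ∷ chain-∷ʳ (y ∷ xs) ch ab

-- A non-backtracking walk never goes up and then down, as the top vertex would have two lower
-- neighbours. So a cycle, read as a closed walk that starts upwards or ends downwards, would have
-- strictly monotone ranks.
module _ (G : Graph) (rank : V G → ℕ)
         (adj⇒rank≢ : ∀ {u v} → Adj G u v → rank u ≢ rank v)
         (lower-neighbour-unique : ∀ {a b c} → Adj G b a → Adj G b c →
                                   rank a < rank b → rank c < rank b → a ≡ c) where

  private
    _≺_ _≻_ : V G → V G → Set
    u ≺ v = rank u < rank v
    u ≻ v = rank v < rank u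

    no-peak : ∀ {x y z} → Adj G x y → Adj G y z → x ≢ z → x ≺ y → y ≻ z → ⊥
    no-peak xy yz x≢z x≺y y≻z = x≢z (lower-neighbour-unique (adj-sym G xy) yz x≺y y≻z)

  EndsDescending : List (V G) → Set
  EndsDescending (x ∷ y ∷ []) = x ≻ y
  EndsDescending (x ∷ y ∷ z ∷ zs) = EndsDescending (y ∷ z ∷ zs)
  EndsDescending _ = ⊥

  endsDescending-∷ʳ : ∀ x xs {p q} → p ≻ q → EndsDescending (x ∷ xs ∷ʳ p ∷ʳ q)
  endsDescending-∷ʳ x [] p≻q = p≻q
  endsDescending-∷ʳ x (y ∷ []) p≻q = p≻q
  endsDescending-∷ʳ x (y ∷ z ∷ ws) p≻q = endsDescending-∷ʳ y (z ∷ ws) p≻q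

  ascending : ∀ {x y zs} → Chain G (x ∷ y ∷ zs) → NonBacktracking (x ∷ y ∷ zs) →
    x ≺ y → Linked _≺_ (x ∷ y ∷ zs)
  ascending {zs = []} _ _ x≺y = x≺y ∷ [-]
  ascending {x} {y} {z ∷ zs} (xy ∷ yz ∷ ch) (x≢z , nb) x≺y with <-cmp (rank y) (rank z)
  ... | tri< y≺z _ _ = x≺y ∷ ascending (yz ∷ ch) nb y≺z
  ... | tri≈ _ y≡z _ = ⊥-elim (adj⇒rank≢ yz y≡z)
  ... | tri> _ _ y≻z = ⊥-elim (no-peak xy yz x≢z x≺y y≻z)

  descending : ∀ {x y zs} → Chain G (x ∷ y ∷ zs) → NonBacktracking (x ∷ y ∷ zs) →
    EndsDescending (x ∷ y ∷ zs) → Linked _≻_ (x ∷ y ∷ zs)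
  descending {zs = []} _ _ x≻y = x≻y ∷ [-]
  descending {x} {y} {z ∷ zs} (xy ∷ ch@(yz ∷ _)) (x≢z , nb) ends
    with descending ch nb ends | <-cmp (rank x) (rank y)
  ... | y≻z⋯ | tri> _ _ x≻y = x≻y ∷ y≻z⋯
  ... | _ | tri≈ _ x≡y _ = ⊥-elim (adj⇒rank≢ xy x≡y)
  ... | y≻z ∷ _ | tri< x≺y _ _ = ⊥-elim (no-peak xy yz x≢z x≺y y≻z)

  acyclic-by-rank : ¬ HasCycle G
  acyclic-by-rank (u , [] , () , _)
  acyclic-by-rank (u , _ ∷ [] , s≤s () , _)
  acyclic-by-rank (u , c₁ ∷ c₂ ∷ ws , _ , uniq , ch@(uc₁ ∷ c₁⋯u)) with <-cmp (rank u) (rank c₁)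
  ... | tri< u≺c₁ _ _ = <-irrefl refl (Linked-closed <-trans (c₁ ∷ c₂ ∷ ws)
          (ascending ch (nonBacktracking-closed _ uniq (s≤s (s≤s z≤n))) u≺c₁))
  ... | tri≈ _ u≡c₁ _ = adj⇒rank≢ uc₁ u≡c₁
  ... | tri> _ _ u≻c₁ =
    -- the rotated closed walk c₁ ⋯ u c₁ ends downwards
    <-irrefl refl (Linked-closed (flip <-trans) (c₂ ∷ ws ∷ʳ u)
          (descending (chain-∷ʳ (c₁ ∷ c₂ ∷ ws) c₁⋯u uc₁)
                      (nonBacktracking-closed (c₂ ∷ ws ∷ʳ u) (unique-rotate uniq) 2≤length)
                      (endsDescending-∷ʳ c₁ (c₂ ∷ ws) u≻c₁)))
    where
    2≤length : 2 ≤ length (c₂ ∷ ws ∷ʳ u)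
    2≤length = s≤s (subst (1 ≤_) (sym (length-++ ws)) (m≤n+m 1 (length ws)))

-- Complete heaps

m/n≡1 : ∀ {m n} .{{_ : NonZero n}} → n ≤ m → m < n + n → m / n ≡ 1
m/n≡1 {m} {n} n≤m m<2n = trans (m/n≡1+[m∸n]/n n≤m) (cong suc (m<n⇒m/n≡0 m∸n<n))
  where
  m∸n<n : m ∸ n < n
  m∸n<n = subst (m ∸ n <_) (m+n∸m≡n n n) (∸-monoˡ-< m<2n n≤m)

module Heap (d : ℕ) .{{_ : NonZero d}} (n : ℕ) where

  parent : ℕ → ℕ
  parent c = pred c / d

  parent< : ∀ {c} → 0 < c → parent c < c
  parent< {suc c} _ = s≤s (m/n≤m c d)

  IsParent : Fin n → Fin n → Set
  IsParent p c = 0 < toℕ c × parent (toℕ c) ≡ toℕ p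

  IsEdge : Fin n → Fin n → Set
  IsEdge u v = IsParent u v ⊎ IsParent v u

  isParent? : ∀ p c → Dec (IsParent p c)
  isParent? p c = (0 <? toℕ c) ×-dec (parent (toℕ c) ≟ℕ toℕ p)

  isEdge? : ∀ u v → Dec (IsEdge u v)
  isEdge? u v = isParent? u v ⊎-dec isParent? v u

  ¬IsParent-self : ∀ u → ¬ IsParent u u
  ¬IsParent-self u (0<u , parent≡u) = <-irrefl parent≡u (parent< 0<u)

  heap : Graph
  heap = record
    { size = n
    ; adj = λ u v → does (isEdge? u v)
    ; sym = λ u v → ∨-comm (does (isParent? u v)) (does (isParent? v u))
    ; irrefl = λ u → dec-false (isEdge? u u) [ ¬IsParent-self u , ¬IsParent-self u ]
    }

  adj⇒edge : ∀ {u v} → Adj heap u v → IsEdge u v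
  adj⇒edge {u} {v} = does⇒witness (isEdge? u v)

  edge⇒adj : ∀ {u v} → IsEdge u v → Adj heap u v
  edge⇒adj {u} {v} = dec-true (isEdge? u v)

  parent-unique : ∀ {p q c} → IsParent p c → IsParent q c → p ≡ q
  parent-unique (_ , c↑≡p) (_ , c↑≡q) = toℕ-injective (trans (sym c↑≡p) c↑≡q)

  lower-neighbour-is-parent : ∀ {u v} → Adj heap u v → toℕ v < toℕ u → IsParent v u
  lower-neighbour-is-parent uv v<u with adj⇒edge uv
  ... | inj₂ v↑u = v↑u
  ... | inj₁ (0<v , v↑≡u) = ⊥-elim (<-asym v<u (subst (_< _) v↑≡u (parent< 0<v)))

  heap-acyclic : ¬ HasCycle heap
  heap-acyclic = acyclic-by-rank heap toℕ
    (λ uv → adj⇒≢ heap uv ∘ toℕ-injective)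
    (λ ba bc a<b c<b → parent-unique (lower-neighbour-is-parent ba a<b) (lower-neighbour-is-parent bc c<b))

  parentVertex : (v : Fin n) → 0 < toℕ v → Fin n
  parentVertex v 0<v = fromℕ< (<-trans (parent< 0<v) (toℕ<n v))

  parentVertex-isParent : ∀ v 0<v → IsParent (parentVertex v 0<v) v
  parentVertex-isParent v 0<v = 0<v , sym (toℕ-fromℕ< _)

  heap-connected : (root : Fin n) → toℕ root ≡ 0 → Connected heap
  heap-connected root root≡0 = connected-by-descent heap toℕ root descend
    where
    descend : ∀ v → v ≢ root → Σ (Fin n) λ w → Adj heap v w × toℕ w < toℕ v
    descend v v≢root = parentVertex v 0<v , edge⇒adj (inj₂ (parentVertex-isParent v 0<v)) ,
                       subst (_< toℕ v) (sym (toℕ-fromℕ< _)) (parent< 0<v)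
      where
      0<v : 0 < toℕ v
      0<v = n≢0⇒n>0 (λ v≡0 → v≢root (toℕ-injective (trans v≡0 (sym root≡0))))

  children : ℕ → List ℕ
  children p = applyUpTo (λ i → suc (i + p * d)) d

  child∈children : ∀ {p c} → IsParent p c → toℕ c ∈ children (toℕ p)
  child∈children {p} {c} (0<c , c↑≡p) =
    subst (_∈ children (toℕ p)) c-digits (∈-applyUpTo⁺ _ (m%n<n (pred (toℕ c)) d))
    where
    open ≡-Reasoning
    c-digits : suc (pred (toℕ c) % d + toℕ p * d) ≡ toℕ c
    c-digits = begin
      suc (pred (toℕ c) % d + toℕ p * d)               ≡⟨ cong (λ q → suc (pred (toℕ c) % d + q * d)) c↑≡p ⟨
      suc (pred (toℕ c) % d + pred (toℕ c) / d * d)    ≡⟨ cong suc (m≡m%n+[m/n]*n (pred (toℕ c)) d) ⟨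
      suc (pred (toℕ c))                               ≡⟨ suc-pred (toℕ c) {{>-nonZero 0<c}} ⟩
      toℕ c                                            ∎

  degree≤ : ∀ u → degree heap u ≤ suc d
  degree≤ u = begin
    degree heap u                     ≤⟨ count≤length*maxFibre _≟ℕ_ toℕ 1 (fibreSize-injective≤1 _≟ℕ_ {n} toℕ toℕ-injective)
                                           neighbours (adj heap u) neighbour∈ ⟩
    length neighbours * 1             ≡⟨ *-identityʳ _ ⟩
    suc (length (children (toℕ u)))   ≡⟨ cong suc (length-applyUpTo _ d) ⟩
    suc d                             ∎
    where
    open ≤-Reasoning
    neighbours : List ℕ
    neighbours = parent (toℕ u) ∷ children (toℕ u)
    neighbour∈ : ∀ w → Adj heap u w → toℕ w ∈ neighbours
    neighbour∈ w uw with adj⇒edge uw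
    ... | inj₁ u↑w = there (child∈children u↑w)
    ... | inj₂ (_ , u↑≡w) = here (sym u↑≡w)

  degree-of-one≥ : (one : Fin n) → toℕ one ≡ 1 → suc (d + d) ≤ n → suc d ≤ degree heap one
  degree-of-one≥ one one≡1 2d<n = begin
    1 + d                                                       ≤⟨ +-mono-≤ root-count child-count ⟩
    sumFin n (indicator ∘ isRoot) + sumFin n (indicator ∘ rest) ≡⟨ sumFin-+ n _ _ ⟨
    sumFin n (λ w → indicator (isRoot w) + indicator (rest w))  ≤⟨ sumFin-mono n (λ w →
                                                                     ≤-reflexive (indicator-merge (isRoot w) _ (root-adj w))) ⟩
    degree heap one                                             ∎
    where
    open ≤-Reasoning
    isRoot rest : Fin n → Bool
    isRoot w = does (toℕ w ≟ℕ 0)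
    rest w = if isRoot w then false else adj heap one w

    root-adj : ∀ w → isRoot w ≡ true → Adj heap one w
    root-adj w w-root = edge⇒adj (inj₂ (subst (0 <_) (sym one≡1) (s≤s z≤n) ,
      trans (cong parent one≡1) (trans (0/n≡0 d) (sym (does⇒witness (toℕ w ≟ℕ 0) w-root)))))

    child-of-one : ∀ w → suc d ≤ toℕ w → toℕ w < suc (d + d) → IsParent one w
    child-of-one w d<w w≤2d = 0<w , trans (m/n≡1 (∸-monoˡ-≤ 1 d<w) (∸-monoˡ-< w≤2d 0<w)) (sym one≡1)
      where
      0<w : 0 < toℕ w
      0<w = ≤-trans (s≤s z≤n) d<w

    root-count : 1 ≤ sumFin n (indicator ∘ isRoot)
    root-count = sumFin-≥-interval n _ 0 1 (≤-trans (s≤s z≤n) 2d<n) λ w _ w<1 →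
      indicator-true (dec-true (toℕ w ≟ℕ 0) (n<1⇒n≡0 w<1))

    child-count : d ≤ sumFin n (indicator ∘ rest)
    child-count = sumFin-≥-interval n _ (suc d) d 2d<n λ w d<w w≤2d → indicator-true (trans
      (cong (λ b → if b then false else adj heap one w) (dec-false (toℕ w ≟ℕ 0) (>⇒≢ (≤-trans (s≤s z≤n) d<w))))
      (edge⇒adj (inj₁ (child-of-one w d<w w≤2d))))

  heap-maxDegree : suc (d + d) ≤ n → HasMaxDegree heap (suc d)
  heap-maxDegree 2d<n = degree≤ , one , ≤-antisym (degree≤ one) (degree-of-one≥ one (toℕ-fromℕ< _) 2d<n)
    where
    one : Fin n
    one = fromℕ< (≤-trans (s≤s (≤-trans (>-nonZero⁻¹ d) (m≤m+n d d))) 2d<n)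

-- Balls of non-backtracking walks

length-filterᵇ : ∀ {A : Set} (p : A → Bool) xs → length (filterᵇ p xs) ≡ foldr _+_ 0 (map (indicator ∘ p) xs)
length-filterᵇ p [] = refl
length-filterᵇ p (x ∷ xs) with p x
... | true = cong suc (length-filterᵇ p xs)
... | false = length-filterᵇ p xs

length-concatMap≤ : ∀ {A B : Set} (f : A → List B) c xs → (∀ x → x ∈ xs → length (f x) ≤ c) →
  length (concatMap f xs) ≤ length xs * c
length-concatMap≤ f c [] _ = z≤n
length-concatMap≤ f c (x ∷ xs) f≤c = begin
  length (f x ++ concatMap f xs)          ≡⟨ length-++ (f x) ⟩
  length (f x) + length (concatMap f xs)  ≤⟨ +-mono-≤ (f≤c x (here refl)) (length-concatMap≤ f c xs (λ y → f≤c y ∘ there)) ⟩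
  c + length xs * c                       ∎
  where open ≤-Reasoning

module Ball (G : Graph) (centre : V G) where

  neighbours : V G → List (V G)
  neighbours u = filterᵇ (adj G u) (allFin (size G))

  ∈-neighbours⁺ : ∀ {u w} → Adj G u w → w ∈ neighbours u
  ∈-neighbours⁺ {u} uw = ∈-filter⁺ (T? ∘ adj G u) (∈-allFin _) (Equivalence.from T-≡ uw)

  ∈-neighbours⁻ : ∀ {u w} → w ∈ neighbours u → Adj G u w
  ∈-neighbours⁻ {u} w∈ = Equivalence.to T-≡ (proj₂ (∈-filter⁻ (T? ∘ adj G u) {xs = allFin (size G)} w∈))

  length-neighbours : ∀ u → length (neighbours u) ≡ degree G u
  length-neighbours u = length-filterᵇ (adj G u) (allFin (size G))

  extend : V G × V G → List (V G × V G)
  extend (p , u) = map (u ,_) (filter (λ w → ¬? (w ≟ p)) (neighbours u))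

  -- (p , u) ∈ Frontier i when some non-backtracking walk of length i + 1 from the centre ends
  -- with the edge p u.
  Frontier : ℕ → List (V G × V G)
  Frontier zero = map (centre ,_) (neighbours centre)
  Frontier (suc i) = concatMap extend (Frontier i)

  Ball : ℕ → List (V G)
  Ball zero = centre ∷ []
  Ball (suc k) = Ball k ++ map proj₂ (Frontier k)

  ∈-extend⁻ : ∀ {p u u′ w} → (u′ , w) ∈ extend (p , u) → u′ ≡ u × Adj G u w
  ∈-extend⁻ {p} {u} m with ∈-map⁻ (u ,_) m
  ... | w , w∈ , refl = refl , ∈-neighbours⁻ (proj₁ (∈-filter⁻ (λ w → ¬? (w ≟ p)) w∈))

  ∈-Frontier-suc⁻ : ∀ {i u w} → (u , w) ∈ Frontier (suc i) →
    Σ (V G) λ p → (p , u) ∈ Frontier i × Adj G u w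
  ∈-Frontier-suc⁻ {i} m with ∈-concat⁻′ (map extend (Frontier i)) m
  ... | _ , m′ , e∈ with ∈-map⁻ extend e∈
  ...   | (p , u) , pu∈ , refl with ∈-extend⁻ m′
  ...     | refl , uw = p , pu∈ , uw

  Frontier-adj : ∀ i {u w} → (u , w) ∈ Frontier i → Adj G u w
  Frontier-adj zero m with ∈-map⁻ (centre ,_) m
  ... | _ , w∈ , refl = ∈-neighbours⁻ w∈
  Frontier-adj (suc i) m with ∈-Frontier-suc⁻ {i} m
  ... | _ , _ , uw = uw

  Frontier-tail∈Ball : ∀ i {u w} → (u , w) ∈ Frontier i → u ∈ Ball i
  Frontier-tail∈Ball zero m with ∈-map⁻ (centre ,_) m
  ... | _ , _ , refl = here refl
  Frontier-tail∈Ball (suc i) m with ∈-Frontier-suc⁻ {i} m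
  ... | p , pu∈ , _ = ∈-++⁺ʳ (Ball i) (∈-map⁺ proj₂ pu∈)

  Ball-mono : ∀ k {t} → t ∈ Ball k → t ∈ Ball (suc k)
  Ball-mono k = ∈-++⁺ˡ

  centre∈Ball : ∀ k → centre ∈ Ball k
  centre∈Ball zero = here refl
  centre∈Ball (suc k) = Ball-mono k (centre∈Ball k)

  Ball-step : ∀ k {t t′} → t ∈ Ball k → Adj G t t′ → t′ ∈ Ball (suc k)
  Ball-step zero (here refl) tt′ = ∈-++⁺ʳ (Ball zero) (∈-map⁺ proj₂ (∈-map⁺ (centre ,_) (∈-neighbours⁺ tt′)))
  Ball-step (suc k) {t} {t′} t∈ tt′ with ∈-++⁻ (Ball k) t∈
  ... | inj₁ t∈Ball = Ball-mono (suc k) (Ball-step k t∈Ball tt′)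
  ... | inj₂ t∈Frontier with ∈-map⁻ proj₂ t∈Frontier
  ...   | (p , .t) , pt∈ , refl with t′ ≟ p
  ...     | yes refl = Ball-mono (suc k) (Ball-mono k (Frontier-tail∈Ball k pt∈))
  ...     | no t′≢p = ∈-++⁺ʳ (Ball (suc k)) (∈-map⁺ proj₂ (∈-concat⁺′ new∈ (∈-map⁺ extend pt∈)))
    where
    new∈ : (t , t′) ∈ extend (p , t)
    new∈ = ∈-map⁺ (t ,_) (∈-filter⁺ (λ w → ¬? (w ≟ p)) (∈-neighbours⁺ tt′) t′≢p)

  Ball-length-suc : ∀ k → length (Ball (suc k)) ≡ length (Ball k) + length (Frontier k)
  Ball-length-suc k = trans (length-++ (Ball k)) (cong (length (Ball k) +_) (length-map proj₂ (Frontier k)))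

  module _ (e : ℕ) (degree≤ : ∀ u → degree G u ≤ suc e) where

    length-neighbours≤ : ∀ u → length (neighbours u) ≤ suc e
    length-neighbours≤ u = subst (_≤ suc e) (sym (length-neighbours u)) (degree≤ u)

    length-extend≤ : ∀ {p u} → Adj G p u → length (extend (p , u)) ≤ e
    length-extend≤ {p} {u} pu = ≤-pred (begin-strict
      length (extend (p , u))                         ≡⟨ length-map (u ,_) (filter (λ w → ¬? (w ≟ p)) (neighbours u)) ⟩
      length (filter (λ w → ¬? (w ≟ p)) (neighbours u)) <⟨ filter-notAll _ (neighbours u) p-excluded ⟩
      length (neighbours u)                           ≤⟨ length-neighbours≤ u ⟩
      suc e                                           ∎)
      where
      open ≤-Reasoning
      p-excluded : Any (λ w → ¬ ¬ w ≡ p) (neighbours u)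
      p-excluded = Any.map (λ p≡w w≢p → w≢p (sym p≡w)) (∈-neighbours⁺ (adj-sym G pu))

    length-Frontier≤ : ∀ i → length (Frontier i) ≤ suc e * e ^ i
    length-Frontier≤ zero = begin
      length (Frontier zero)   ≡⟨ length-map (centre ,_) (neighbours centre) ⟩
      length (neighbours centre) ≤⟨ length-neighbours≤ centre ⟩
      suc e                    ≡⟨ *-identityʳ (suc e) ⟨
      suc e * 1                ∎
      where open ≤-Reasoning
    length-Frontier≤ (suc i) = begin
      length (Frontier (suc i)) ≤⟨ length-concatMap≤ extend e (Frontier i) (λ _ m → length-extend≤ (Frontier-adj i m)) ⟩
      length (Frontier i) * e   ≤⟨ *-monoˡ-≤ e (length-Frontier≤ i) ⟩
      suc e * e ^ i * e         ≡⟨ reassoc (suc e) (e ^ i) e ⟩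
      suc e * e ^ suc i         ∎
      where
      open ≤-Reasoning
      reassoc : ∀ a b c → a * b * c ≡ a * (c * b)
      reassoc = solve-∀

    length-Ball≤ : 2 ≤ e → ∀ k → length (Ball k) ≤ suc e * e ^ k
    length-Ball≤ _ zero = s≤s z≤n
    length-Ball≤ 2≤e (suc k) = begin
      length (Ball (suc k))                  ≡⟨ Ball-length-suc k ⟩
      length (Ball k) + length (Frontier k)  ≤⟨ +-mono-≤ (length-Ball≤ 2≤e k) (length-Frontier≤ k) ⟩
      suc e * e ^ k + suc e * e ^ k          ≡⟨ double (suc e * e ^ k) ⟩
      2 * (suc e * e ^ k)                    ≤⟨ *-monoˡ-≤ (suc e * e ^ k) 2≤e ⟩
      e * (suc e * e ^ k)                    ≡⟨ reassoc e (suc e) (e ^ k) ⟩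
      suc e * e ^ suc k                      ∎
      where
      open ≤-Reasoning
      double : ∀ a → a + a ≡ 2 * a
      double = solve-∀
      reassoc : ∀ a b c → a * (b * c) ≡ b * (a * c)
      reassoc = solve-∀

  length-Ball≤-path : (∀ u → degree G u ≤ 2) → ∀ k → length (Ball k) ≤ 1 + 2 * k
  length-Ball≤-path _ zero = s≤s z≤n
  length-Ball≤-path degree≤2 (suc k) = begin
    length (Ball (suc k))                  ≡⟨ Ball-length-suc k ⟩
    length (Ball k) + length (Frontier k)  ≤⟨ +-mono-≤ (length-Ball≤-path degree≤2 k) (length-Frontier≤ 1 degree≤2 k) ⟩
    1 + 2 * k + 2 * 1 ^ k                  ≡⟨ cong (λ x → 1 + 2 * k + 2 * x) (^-zeroˡ k) ⟩
    1 + 2 * k + 2 * 1                      ≡⟨ tidy k ⟩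
    1 + 2 * suc k                          ∎
    where
    open ≤-Reasoning
    tidy : ∀ k → 1 + 2 * k + 2 * 1 ≡ 1 + 2 * suc k
    tidy = solve-∀

module CompleteHeap (d : ℕ) .{{_ : NonZero d}} (h : ℕ) where
  open Heap d (d ^ h) public

  root : Fin (d ^ h)
  root = fromℕ< (m^n>0 d h)

  is-root : ∀ v → toℕ v ≡ 0 → v ≡ root
  is-root v v≡0 = toℕ-injective (trans v≡0 (sym (toℕ-fromℕ< _)))

  heap-isTree : IsTree heap
  heap-isTree = heap-connected root (toℕ-fromℕ< _) , heap-acyclic

  parent-depth : ∀ {c} k → 0 < c → c < d ^ suc k → parent c < d ^ k
  parent-depth {c} k 0<c c<d^k+1 = m<n*o⇒m/o<n (begin-strict
    pred c     <⟨ ≤-reflexive (suc-pred c {{>-nonZero 0<c}}) ⟩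
    c          <⟨ c<d^k+1 ⟩
    d * d ^ k  ≡⟨ *-comm d (d ^ k) ⟩
    d ^ k * d  ∎)
    where open ≤-Reasoning

  module _ (T : Graph) (f : Fin (d ^ h) → V T) (isPartition : IsTPartition heap T f) where
    open Ball T (f root)

    parent-in-Ball⇒in-Ball : ∀ k {p v} → IsParent p v → f p ∈ Ball k → f v ∈ Ball (suc k)
    parent-in-Ball⇒in-Ball k {p} {v} p↑v fp∈ with isPartition p v (edge⇒adj (inj₁ p↑v))
    ... | inj₁ fp≡fv = Ball-mono k (subst (_∈ Ball k) fp≡fv fp∈)
    ... | inj₂ fp~fv = Ball-step k fp∈ fp~fv

    within-Ball : ∀ k v → toℕ v < d ^ k → f v ∈ Ball k
    within-Ball zero v v<1 with refl ← is-root v (n<1⇒n≡0 v<1) = here refl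
    within-Ball (suc k) v v<d^k+1 with toℕ v ≟ℕ 0
    ... | yes v≡0 with refl ← is-root v v≡0 = centre∈Ball (suc k)
    ... | no v≢0 = parent-in-Ball⇒in-Ball k (parentVertex-isParent v 0<v)
                     (within-Ball k (parentVertex v 0<v) p<d^k)
      where
      0<v : 0 < toℕ v
      0<v = n≢0⇒n>0 v≢0
      p<d^k : toℕ (parentVertex v 0<v) < d ^ k
      p<d^k = subst (_< d ^ k) (sym (toℕ-fromℕ< _)) (parent-depth k 0<v v<d^k+1)

    heap-size≤Ball*width : d ^ h ≤ length (Ball h) * width heap T f
    heap-size≤Ball*width = size≤length*width heap T f (Ball h) (λ v → within-Ball h v (toℕ<n v))

-- Choice of parameters

heap-good : ∀ d .{{_ : NonZero d}} h p q → suc (d + d) ≤ d ^ h →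
  (∀ (T : Graph) f → (∀ x → degree T x ≤ d) → IsTPartition (CompleteHeap.heap d h) T f →
     (d ^ h) ^ p ≤ width (CompleteHeap.heap d h) T f ^ q) →
  Good (suc d) p q (CompleteHeap.heap d h)
heap-good d h p q 2d<d^h width-bound =
  heap-isTree , heap-maxDegree 2d<d^h , λ T _ degree<d+1 f → width-bound T f (≤-pred ∘ degree<d+1)
  where open CompleteHeap d h

n<2^n : ∀ n → n < 2 ^ n
n<2^n zero = s≤s z≤n
n<2^n (suc n) = begin-strict
  suc n            <⟨ s≤s (n<2^n n) ⟩
  1 + 2 ^ n        ≤⟨ +-monoˡ-≤ (2 ^ n) (m^n>0 2 n) ⟩
  2 ^ n + 2 ^ n    ≡⟨ cong (2 ^ n +_) (+-identityʳ (2 ^ n)) ⟨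
  2 ^ suc n        ∎
  where open ≤-Reasoning

2d<d^h : ∀ {d h} → 2 ≤ d → 3 ≤ h → suc (d + d) ≤ d ^ h
2d<d^h {d} {h} 2≤d 3≤h = begin
  suc (d + d)      ≤⟨ +-monoˡ-≤ (d + d) (≤-trans (s≤s z≤n) (≤-trans 2≤d (m≤m+n d d))) ⟩
  d + d + (d + d)  ≡⟨ four-d d ⟩
  2 * (2 * d)      ≤⟨ *-mono-≤ 2≤d (*-mono-≤ 2≤d (≤-reflexive (sym (*-identityʳ d)))) ⟩
  d ^ 3            ≤⟨ ^-monoʳ-≤ d {{>-nonZero (≤-trans (s≤s z≤n) 2≤d)}} 3≤h ⟩
  d ^ h            ∎
  where
  open ≤-Reasoning
  four-d : ∀ d → d + d + (d + d) ≡ 2 * (2 * d)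
  four-d = solve-∀

^-distribʳ-* : ∀ m n o → (m * n) ^ o ≡ m ^ o * n ^ o
^-distribʳ-* m n zero = refl
^-distribʳ-* m n (suc o) = trans (cong (m * n *_) (^-distribʳ-* m n o)) (interchange* m n (m ^ o) (n ^ o))
  where
  interchange* : ∀ a b c d → a * b * (c * d) ≡ a * c * (b * d)
  interchange* = solve-∀

bernoulli : ∀ a j → a ^ j * (a + j) ≤ a * suc a ^ j
bernoulli a zero = ≤-reflexive (trans (+-identityʳ _) (trans (+-identityʳ a) (sym (*-identityʳ a))))
bernoulli a (suc j) = begin
  a * a ^ j * (a + suc j)                  ≤⟨ m≤m+n _ (a ^ j * j) ⟩
  a * a ^ j * (a + suc j) + a ^ j * j      ≡⟨ expand a (a ^ j) j ⟩
  suc a * (a ^ j * (a + j))                ≤⟨ *-monoʳ-≤ (suc a) (bernoulli a j) ⟩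
  suc a * (a * suc a ^ j)                  ≡⟨ swap (suc a) a (suc a ^ j) ⟩
  a * (suc a * suc a ^ j)                  ∎
  where
  open ≤-Reasoning
  expand : ∀ a x j → a * x * (a + suc j) + x * j ≡ suc a * (x * (a + j))
  expand = solve-∀
  swap : ∀ x y z → x * (y * z) ≡ y * (x * z)
  swap = solve-∀

-- Chosen so that a + q = a(a + 1)², which turns Bernoulli's inequality into (a + 1)² a^q ≤ (a + 1)^q.
growthExponent : ℕ → ℕ
growthExponent a = a * (a * (a + 2))

growthExponent-nonZero : ∀ a .{{_ : NonZero a}} → NonZero (growthExponent a)
growthExponent-nonZero a {{a≢0}} = m*n≢0 a (a * (a + 2)) {{a≢0}} {{m*n≢0 a (a + 2) {{a≢0}} {{>-nonZero (≤-trans (s≤s z≤n) (m≤n+m 2 a))}}}}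

[1+a]²a^q≤[1+a]^q : ∀ a .{{_ : NonZero a}} →
  suc a * suc a * a ^ growthExponent a ≤ suc a ^ growthExponent a
[1+a]²a^q≤[1+a]^q a = *-cancelˡ-≤ a (begin
  a * (suc a * suc a * a ^ q)  ≡⟨ rearrange a (a ^ q) ⟩
  a ^ q * (a + q)              ≤⟨ bernoulli a q ⟩
  a * suc a ^ q                ∎)
  where
  open ≤-Reasoning
  q = growthExponent a
  rearrange : ∀ a x → a * (suc a * suc a * x) ≡ x * (a + a * (a * (a + 2)))
  rearrange = solve-∀

width≥[1+a]^t : ∀ a .{{_ : NonZero a}} t .{{_ : NonZero t}} w →
  let h = growthExponent a * t in
  suc a ^ h ≤ suc a * a ^ h * w → suc a ^ t ≤ w
width≥[1+a]^t a t w heap≤ball*w =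
  *-cancelʳ-≤ (suc a ^ t) w (suc a * a ^ h) {{ball-nonZero}} (begin
    suc a ^ t * (suc a * a ^ h)          ≤⟨ *-monoʳ-≤ (suc a ^ t) (*-monoˡ-≤ (a ^ h) 1+a≤[1+a]^t) ⟩
    suc a ^ t * (suc a ^ t * a ^ h)      ≡⟨ regroup ⟩
    (suc a * suc a * a ^ q) ^ t          ≤⟨ ^-monoˡ-≤ t ([1+a]²a^q≤[1+a]^q a) ⟩
    (suc a ^ q) ^ t                      ≡⟨ ^-*-assoc (suc a) q t ⟩
    suc a ^ h                            ≤⟨ heap≤ball*w ⟩
    suc a * a ^ h * w                    ≡⟨ *-comm (suc a * a ^ h) w ⟩
    w * (suc a * a ^ h)                  ∎)
  where
  open ≤-Reasoning
  q = growthExponent a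
  h = q * t
  ball-nonZero : NonZero (suc a * a ^ h)
  ball-nonZero = m*n≢0 (suc a) (a ^ h) {{_}} {{m^n≢0 a h}}
  1+a≤[1+a]^t : suc a ≤ suc a ^ t
  1+a≤[1+a]^t = subst (_≤ suc a ^ t) (^-identityʳ (suc a)) (^-monoʳ-≤ (suc a) (>-nonZero⁻¹ t))
  regroup : suc a ^ t * (suc a ^ t * a ^ h) ≡ (suc a * suc a * a ^ q) ^ t
  regroup = begin-equality
    suc a ^ t * (suc a ^ t * a ^ h)      ≡⟨ *-assoc (suc a ^ t) _ _ ⟨
    suc a ^ t * suc a ^ t * a ^ h        ≡⟨ cong₂ _*_ (^-distribʳ-* (suc a) (suc a) t) (^-*-assoc a q t) ⟨
    (suc a * suc a) ^ t * (a ^ q) ^ t    ≡⟨ ^-distribʳ-* (suc a * suc a) (a ^ q) t ⟨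
    (suc a * suc a * a ^ q) ^ t          ∎

manyGoodTrees-Δ≥4 : ∀ a → 2 ≤ a → InfinitelyManyGood (suc (suc a)) 1 (growthExponent a)
manyGoodTrees-Δ≥4 a 2≤a N = heap , N≤size , heap-good (suc a) h 1 q (2d<d^h (s≤s 1≤a) 3≤h) width-bound
  where
  1≤a : 1 ≤ a
  1≤a = ≤-trans (s≤s z≤n) 2≤a
  instance
    a≢0 : NonZero a
    a≢0 = >-nonZero 1≤a
  q t h : ℕ
  q = growthExponent a
  t = suc N
  h = q * t
  open CompleteHeap (suc a) h
  instance
    q≢0 : NonZero q
    q≢0 = growthExponent-nonZero a
  3≤h : 3 ≤ h
  3≤h = ≤-trans (*-mono-≤ 1≤a (*-mono-≤ 1≤a (+-monoˡ-≤ 2 1≤a))) (m≤m*n q t)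
  N≤size : N ≤ suc a ^ h
  N≤size = ≤-trans (n≤1+n N) (≤-trans (m≤n*m t q) (≤-trans (<⇒≤ (n<2^n h)) (^-monoˡ-≤ h (s≤s 1≤a))))
  width-bound : ∀ T f → (∀ x → degree T x ≤ suc a) → IsTPartition heap T f → (suc a ^ h) ^ 1 ≤ width heap T f ^ q
  width-bound T f degree≤ isPartition = begin
    (suc a ^ h) ^ 1  ≡⟨ ^-identityʳ _ ⟩
    suc a ^ (q * t)  ≡⟨ cong (suc a ^_) (*-comm q t) ⟩
    suc a ^ (t * q)  ≡⟨ ^-*-assoc (suc a) t q ⟨
    (suc a ^ t) ^ q  ≤⟨ ^-monoˡ-≤ q (width≥[1+a]^t a t w heap≤ball*w) ⟩
    w ^ q            ∎
    where
    open ≤-Reasoning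
    w = width heap T f
    heap≤ball*w : suc a ^ h ≤ suc a * a ^ h * w
    heap≤ball*w = ≤-trans (heap-size≤Ball*width T f isPartition)
                          (*-monoˡ-≤ w (Ball.length-Ball≤ T (f root) a degree≤ 2≤a h))

width≥2^[sp] : ∀ p q s w → p < q → 1 + 2 * (q * s) ≤ 2 ^ s →
  2 ^ (q * s) ≤ (1 + 2 * (q * s)) * w → 2 ^ (s * p) ≤ w
width≥2^[sp] p q s w p<q ball≤2^s heap≤ball*w = *-cancelˡ-≤ (1 + 2 * (q * s)) (begin
  (1 + 2 * (q * s)) * 2 ^ (s * p)  ≤⟨ *-monoˡ-≤ (2 ^ (s * p)) ball≤2^s ⟩
  2 ^ s * 2 ^ (s * p)              ≡⟨ ^-distribˡ-+-* 2 s (s * p) ⟨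
  2 ^ (s + s * p)                  ≡⟨ cong (2 ^_) (*-suc s p) ⟨
  2 ^ (s * suc p)                  ≤⟨ ^-monoʳ-≤ 2 (*-monoʳ-≤ s p<q) ⟩
  2 ^ (s * q)                      ≡⟨ cong (2 ^_) (*-comm s q) ⟩
  2 ^ (q * s)                      ≤⟨ heap≤ball*w ⟩
  (1 + 2 * (q * s)) * w            ∎)
  where open ≤-Reasoning

1+2qs≤2^s : ∀ q u → 4 * q ≤ u → 1 + 2 * (q * (u + u)) ≤ 2 ^ (u + u)
1+2qs≤2^s q u 4q≤u = begin
  1 + 2 * (q * (u + u))  ≡⟨ regroup q u ⟩
  1 + u * (4 * q)        ≤⟨ +-monoʳ-≤ 1 (*-monoʳ-≤ u 4q≤u) ⟩
  1 + u * u              ≤⟨ m≤m+n (1 + u * u) (u + u) ⟩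
  1 + u * u + (u + u)    ≡⟨ square u ⟩
  suc u * suc u          ≤⟨ *-mono-≤ (n<2^n u) (n<2^n u) ⟩
  2 ^ u * 2 ^ u          ≡⟨ ^-distribˡ-+-* 2 u u ⟨
  2 ^ (u + u)            ∎
  where
  open ≤-Reasoning
  regroup : ∀ q u → 1 + 2 * (q * (u + u)) ≡ 1 + u * (4 * q)
  regroup = solve-∀
  square : ∀ u → 1 + u * u + (u + u) ≡ suc u * suc u
  square = solve-∀

manyGoodTrees-Δ≡3 : ∀ p q → p < q → InfinitelyManyGood 3 p q
manyGoodTrees-Δ≡3 p q p<q N = heap , N≤size , heap-good 2 h p q (2d<d^h ≤-refl 3≤h) width-bound
  where
  u s h : ℕ
  u = 4 * q + N
  s = u + u
  h = q * s
  open CompleteHeap 2 h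
  instance
    q≢0 : NonZero q
    q≢0 = >-nonZero (≤-trans (s≤s z≤n) p<q)
  u≤h : u ≤ h
  u≤h = ≤-trans (m≤m+n u u) (m≤n*m s q)
  3≤h : 3 ≤ h
  3≤h = ≤-trans (≤-trans (m≤m*n 3 q) (≤-trans (*-monoˡ-≤ q (n≤1+n 3)) (m≤m+n (4 * q) N))) u≤h
  N≤size : N ≤ 2 ^ h
  N≤size = ≤-trans (m≤n+m N (4 * q)) (≤-trans u≤h (<⇒≤ (n<2^n h)))
  width-bound : ∀ T f → (∀ x → degree T x ≤ 2) → IsTPartition heap T f → (2 ^ h) ^ p ≤ width heap T f ^ q
  width-bound T f degree≤2 isPartition = begin
    (2 ^ h) ^ p        ≡⟨ ^-*-assoc 2 h p ⟩
    2 ^ (q * s * p)    ≡⟨ cong (2 ^_) (rotate q s p) ⟩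
    2 ^ (s * p * q)    ≡⟨ ^-*-assoc 2 (s * p) q ⟨
    (2 ^ (s * p)) ^ q  ≤⟨ ^-monoˡ-≤ q (width≥2^[sp] p q s w p<q (1+2qs≤2^s q u (m≤m+n (4 * q) N)) heap≤ball*w) ⟩
    w ^ q              ∎
    where
    open ≤-Reasoning
    w = width heap T f
    rotate : ∀ q s p → q * s * p ≡ s * p * q
    rotate = solve-∀
    heap≤ball*w : 2 ^ h ≤ (1 + 2 * h) * w
    heap≤ball*w = ≤-trans (heap-size≤Ball*width T f isPartition)
                          (*-monoˡ-≤ w (Ball.length-Ball≤-path T (f root) degree≤2 h))

proposition3 : ((Δ : ℕ) → 3 ≤ Δ →
                  Σ ℕ λ p → Σ ℕ λ q → (0 < p) × (0 < q) × InfinitelyManyGood Δ p q)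
               × ((p q : ℕ) → 0 < p → p < q → InfinitelyManyGood 3 p q)
proposition3 = some-exponent , λ p q _ → manyGoodTrees-Δ≡3 p q
  where
  some-exponent : (Δ : ℕ) → 3 ≤ Δ → Σ ℕ λ p → Σ ℕ λ q → (0 < p) × (0 < q) × InfinitelyManyGood Δ p q
  some-exponent 1 (s≤s ())
  some-exponent 2 (s≤s (s≤s ()))
  some-exponent 3 _ = 1 , 2 , s≤s z≤n , s≤s z≤n , manyGoodTrees-Δ≡3 1 2 (s≤s (s≤s z≤n))
  some-exponent (suc (suc a@(suc (suc _)))) _ =
    1 , growthExponent a , s≤s z≤n , >-nonZero⁻¹ _ {{growthExponent-nonZero a}} , manyGoodTrees-Δ≥4 a (s≤s (s≤s z≤n))
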